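{- If $T$ is a threshold graph, then its domination polynomial $D(T,x)$ has a unimodal coefficient sequence.
   Context: A set $S\subseteq V(G)$ is dominating if every vertex is in $S$ or adjacent to a vertex of $S$; the domination polynomial is $D(G,x)=\sum_{k=0}^n d_k(G)x^k$ where $d_k(G)$ is the number of dominating sets of size $k$. A graph $T$ on $n$ vertices is a threshold graph if there is an ordering $v_1,\dots,v_n$ of its vertices such that each $v_j$ is either isolated or adjacent to all of $v_1,\dots,v_{j-1}$ in the induced subgraph on $\{v_1,\dots,v_j\}$. A sequence $c_0,\dots,c_N$ is unimodal if there is an index $j$ with $c_0\le\cdots\le c_j\ge\cdots\ge c_N$. -}

module Defs where

open import Data.Nat using (ℕ; zero; suc; _≤_; _<_)
open import Data.Bool using (Bool; true; false)
import Data.Bool as B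
open import Data.Fin using (Fin)
import Data.Fin as F
open import Data.Fin.Subset using (Subset; _∈_; ∣_∣)
open import Data.Fin.Subset.Properties using (_∈?_)
open import Data.Fin.Properties using (all?; any?)
open import Data.Fin.Permutation using (Permutation′; _⟨$⟩ʳ_)
open import Data.Vec using (_∷_; [])
open import Data.List using (List; []; _∷_; map; _++_; filter; length)
open import Data.Product using (Σ; ∃; ∃-syntax; _×_; _,_)
open import Data.Sum using (_⊎_)
open import Relation.Nullary using (Dec)
open import Relation.Nullary.Decidable using (_⊎-dec_) renaming (_×-dec_ to _×-dec_)
open import Relation.Binary.PropositionalEquality using (_≡_)
import Data.Nat as N

record Graph (n : ℕ) : Set where
  field
    adj     : Fin n → Fin n → Bool
    sym     : ∀ u v → adj u v ≡ adj v u
    irrefl  : ∀ v → adj v v ≡ false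
open Graph public

Adj : ∀ {n} → Graph n → Fin n → Fin n → Set
Adj G u v = adj G u v ≡ true

Dominating : ∀ {n} → Graph n → Subset n → Set
Dominating G S = ∀ v → v ∈ S ⊎ ∃[ u ] (u ∈ S × Adj G u v)

dominating? : ∀ {n} (G : Graph n) (S : Subset n) → Dec (Dominating G S)
dominating? G S = all? (λ v → (v ∈? S) ⊎-dec any? (λ u → (u ∈? S) ×-dec (adj G u v B.≟ true)))

subsets : ∀ n → List (Subset n)
subsets zero = [] ∷ []
subsets (suc n) = map (true ∷_) (subsets n) ++ map (false ∷_) (subsets n)

domCoeff : ∀ {n} → Graph n → ℕ → ℕ
domCoeff {n} G k =
  length (filter (λ S → (∣ S ∣ N.≟ k) ×-dec dominating? G S) (subsets n))

IsThreshold : ∀ {n} → Graph n → Set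
IsThreshold {n} G = Σ (Permutation′ n) λ σ → ∀ (j : Fin n) →
    (∀ (i : Fin n) → i F.< j → adj G (σ ⟨$⟩ʳ i) (σ ⟨$⟩ʳ j) ≡ false)
  ⊎ (∀ (i : Fin n) → i F.< j → adj G (σ ⟨$⟩ʳ i) (σ ⟨$⟩ʳ j) ≡ true)

Unimodal : (ℕ → ℕ) → ℕ → Set
Unimodal c N = ∃[ j ] (j ≤ N
  × (∀ i → i < j → c i ≤ c (suc i))
  × (∀ i → j ≤ i → i < N → c (suc i) ≤ c i))

{-# OPTIONS --safe #-}
module Submission where

-- Delete the last vertex v of a threshold ordering: what remains is threshold, and v is either
-- isolated, so that D(T,x) = x D(T-v,x), or adjacent to all other vertices, so that T and T-v have
-- the same non-dominating sets and d_k(T) = C(n-1,k-1) + d_k(T-v).  An isolated vertex only shifts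
-- the sequence.  After a dominating vertex the coefficients increase up to n/2 because all these
-- sequences have the normalized matching property d_k (n-k) ≤ d_(k+1) (k+1), and they decrease
-- beyond n/2 because the counts a_k of non-dominating k-sets drop, above the middle, by at most as
-- much as the binomial row, and, below the middle, by at most twice a Catalan number (the largest
-- drop C(2k,k) - C(2k,k+1) of any binomial row at k).  The two drop bounds are carried through the
-- recursion together: each operation needs one of them at the middle to restore the other.

open import Defs hiding (sym)
open import Data.Nat
open import Data.Nat.Properties
open import Data.Nat.Tactic.RingSolver using (solve-∀)
open import Data.Bool using (true; false)
open import Data.Fin as Fin using (Fin; zero; suc; punchIn; punchOut; fromℕ; toℕ)
import Data.Fin.Properties as Fin
open import Data.Fin.Permutation using (_⟨$⟩ʳ_; _⟨$⟩ˡ_; remove; inverseʳ; punchIn-permute)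
open import Data.Fin.Subset using (Subset; _∈_; ∣_∣)
open import Data.Vec using (_∷_; insertAt)
open import Data.Vec.Properties using (insertAt-lookup; insertAt-punchIn; []=⇒lookup; lookup⇒[]=)
open import Data.List using (List; _∷_; []; map; _++_; filter; length)
open import Data.List.Properties using (filter-++; length-++; filter-none; filter-≐)
open import Data.List.Relation.Unary.All using (universal)
open import Data.Product using (∃-syntax; _×_; _,_; proj₁; proj₂)
open import Data.Sum using (_⊎_; inj₁; inj₂)
open import Data.Empty using (⊥-elim)
open import Function using (_∘_)
open import Relation.Nullary using (¬_; does; yes; no)
open import Relation.Nullary.Decidable using (_×-dec_)
open import Relation.Unary using (Decidable)
open import Relation.Binary.PropositionalEquality

double : ℕ → ℕ
double zero    = 0
double (suc k) = suc (suc (double k))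

double≡+ : ∀ k → double k ≡ k + k
double≡+ zero    = refl
double≡+ (suc k) = cong suc (trans (cong suc (double≡+ k)) (sym (+-suc k k)))

suc+suc≡double-suc : ∀ k → suc k + suc k ≡ double (suc k)
suc+suc≡double-suc k = trans (cong suc (+-suc k k)) (cong (λ x → suc (suc x)) (sym (double≡+ k)))

double-mono-≤ : ∀ {i j} → i ≤ j → double i ≤ double j
double-mono-≤ z≤n       = z≤n
double-mono-≤ (s≤s i≤j) = s≤s (s≤s (double-mono-≤ i≤j))

double-⌊/2⌋≤ : ∀ N → double ⌊ N /2⌋ ≤ N
double-⌊/2⌋≤ 0             = z≤n
double-⌊/2⌋≤ 1             = z≤n
double-⌊/2⌋≤ (suc (suc N)) = s≤s (s≤s (double-⌊/2⌋≤ N))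

≤suc-double-⌊/2⌋ : ∀ N → N ≤ suc (double ⌊ N /2⌋)
≤suc-double-⌊/2⌋ 0             = z≤n
≤suc-double-⌊/2⌋ 1             = s≤s z≤n
≤suc-double-⌊/2⌋ (suc (suc N)) = s≤s (s≤s (≤suc-double-⌊/2⌋ N))

infix 8 _choose_

_choose_ : ℕ → ℕ → ℕ
n     choose zero  = 1
zero  choose suc k = 0
suc n choose suc k = n choose k + n choose suc k

choose-1 : ∀ n → n choose 1 ≡ n
choose-1 zero    = refl
choose-1 (suc n) = cong suc (choose-1 n)

choose-absorption : ∀ n k → suc n choose suc k * suc k ≡ suc n * n choose k
choose-absorption zero    zero    = refl
choose-absorption zero    (suc k) = refl
choose-absorption (suc n) zero    =
  trans (*-identityʳ _) (trans (choose-1 (suc (suc n))) (sym (*-identityʳ _)))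
choose-absorption (suc n) (suc k) = begin
  (X + Y + W) * suc (suc k)                    ≡⟨ split X Y W k ⟩
  (X + Y) * suc k + (X + Y) + W * suc (suc k)  ≡⟨ cong₂ (λ u v → u + (X + Y) + v)
                                                    (choose-absorption n k) (choose-absorption n (suc k)) ⟩
  suc n * X + (X + Y) + suc n * Y              ≡⟨ collect X Y n ⟩
  suc (suc n) * (X + Y)                        ∎
  where
  open ≡-Reasoning
  X = n choose k
  Y = n choose suc k
  W = suc n choose suc (suc k)
  split : ∀ X Y W k → (X + Y + W) * suc (suc k) ≡ (X + Y) * suc k + (X + Y) + W * suc (suc k)
  split = solve-∀
  collect : ∀ X Y n → suc n * X + (X + Y) + suc n * Y ≡ suc (suc n) * (X + Y)
  collect = solve-∀

-- C(n,k+1)(k+1) = C(n,k)(n-k), with the subtraction moved to the left.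
choose-ratio : ∀ n k → n choose suc k * suc k + n choose k * suc k ≡ n choose k * suc n
choose-ratio n k = begin
  n choose suc k * suc k + n choose k * suc k  ≡⟨ sym (*-distribʳ-+ (suc k) (n choose suc k) (n choose k)) ⟩
  (n choose suc k + n choose k) * suc k        ≡⟨ cong (_* suc k) (+-comm (n choose suc k) (n choose k)) ⟩
  suc n choose suc k * suc k                   ≡⟨ choose-absorption n k ⟩
  suc n * n choose k                           ≡⟨ *-comm (suc n) _ ⟩
  n choose k * suc n                           ∎
  where open ≡-Reasoning

choose-suc≤choose : ∀ n k → n ≤ suc (double k) → n choose suc k ≤ n choose k
choose-suc≤choose n k n≤2k+1 = *-cancelʳ-≤ _ _ (suc k) (+-cancelʳ-≤ (C * suc k) _ _ (begin
  n choose suc k * suc k + C * suc k  ≡⟨ choose-ratio n k ⟩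
  C * suc n                           ≤⟨ *-monoʳ-≤ C (s≤s n≤2k+1) ⟩
  C * double (suc k)                  ≡⟨ cong (C *_) (sym (suc+suc≡double-suc k)) ⟩
  C * (suc k + suc k)                 ≡⟨ *-distribˡ-+ C (suc k) (suc k) ⟩
  C * suc k + C * suc k               ∎))
  where
  open ≤-Reasoning
  C = n choose k

choose≤choose-suc : ∀ n k → suc (double k) ≤ n → n choose k ≤ n choose suc k
choose≤choose-suc n k 2k+1≤n = *-cancelʳ-≤ _ _ (suc k) (+-cancelʳ-≤ (C * suc k) _ _ (begin
  C * suc k + C * suc k               ≡⟨ sym (*-distribˡ-+ C (suc k) (suc k)) ⟩
  C * (suc k + suc k)                 ≡⟨ cong (C *_) (suc+suc≡double-suc k) ⟩
  C * double (suc k)                  ≤⟨ *-monoʳ-≤ C (s≤s 2k+1≤n) ⟩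
  C * suc n                           ≡⟨ choose-ratio n k ⟨
  n choose suc k * suc k + C * suc k  ∎))
  where
  open ≤-Reasoning
  C = n choose k

choose-ratio-exact : ∀ {n} i j → i + j ≡ n → n choose suc i * suc i ≡ n choose i * j
choose-ratio-exact {n} i j i+j≡n = +-cancelʳ-≡ (C * suc i) _ _ (begin
  n choose suc i * suc i + C * suc i  ≡⟨ choose-ratio n i ⟩
  C * suc n                           ≡⟨ cong (λ x → C * suc x) (sym i+j≡n) ⟩
  C * suc (i + j)                     ≡⟨ cong (C *_) (+-comm (suc i) j) ⟩
  C * (j + suc i)                     ≡⟨ *-distribˡ-+ C j (suc i) ⟩
  C * j + C * suc i                   ∎)
  where
  open ≡-Reasoning
  C = n choose i

choose-central-odd : ∀ k → suc (double k) choose suc k ≡ suc (double k) choose k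
choose-central-odd k = *-cancelʳ-≡ _ _ (suc k)
  (choose-ratio-exact k (suc k) (trans (+-suc k k) (cong suc (sym (double≡+ k)))))

module _ (k : ℕ) where
  private
    n = double (suc k)
    W = n choose k
    X = n choose suc k
    Y = n choose suc (suc k)
    Z = n choose suc (suc (suc k))

    on-row : ∀ i j → i + j ≡ suc k + suc k → i + j ≡ n
    on-row i j e = trans e (suc+suc≡double-suc k)

    Y-ratio : Y * suc (suc k) ≡ X * suc k
    Y-ratio = choose-ratio-exact (suc k) (suc k) (on-row (suc k) (suc k) refl)

    X-ratio : X * suc k ≡ W * suc (suc k)
    X-ratio = choose-ratio-exact k (suc (suc k)) (on-row k (suc (suc k)) (+-suc k (suc k)))

    Z-ratio : Z * suc (suc (suc k)) ≡ Y * k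
    Z-ratio = choose-ratio-exact (suc (suc k)) k (on-row (suc (suc k)) k (cong suc (sym (+-suc k k))))

  choose-symmetric-even : W ≡ Y
  choose-symmetric-even = *-cancelʳ-≡ _ _ (suc (suc k)) (trans (sym X-ratio) (sym Y-ratio))

  choose-concave-right-of-centre : X + Z ≤ Y + Y
  choose-concave-right-of-centre = *-cancelʳ-≤ _ _ (suc k * suc (suc (suc k))) (begin
    (X + Z) * (suc k * suc (suc (suc k)))                    ≡⟨ expand X Z k ⟩
    X * suc k * suc (suc (suc k)) + Z * suc (suc (suc k)) * suc k
      ≡⟨ cong₂ (λ u v → u * suc (suc (suc k)) + v * suc k) (sym Y-ratio) Z-ratio ⟩
    Y * suc (suc k) * suc (suc (suc k)) + Y * k * suc k      ≡⟨ factor Y k ⟩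
    Y * (suc (suc k) * suc (suc (suc k)) + k * suc k)        ≤⟨ *-monoʳ-≤ Y (m≤m+n _ (k + k)) ⟩
    Y * (suc (suc k) * suc (suc (suc k)) + k * suc k + (k + k)) ≡⟨ regroup Y k ⟩
    (Y + Y) * (suc k * suc (suc (suc k)))                    ∎)
    where
    open ≤-Reasoning
    expand : ∀ X Z k → (X + Z) * (suc k * suc (suc (suc k)))
                     ≡ X * suc k * suc (suc (suc k)) + Z * suc (suc (suc k)) * suc k
    expand = solve-∀
    factor : ∀ Y k → Y * suc (suc k) * suc (suc (suc k)) + Y * k * suc k
                   ≡ Y * (suc (suc k) * suc (suc (suc k)) + k * suc k)
    factor = solve-∀
    regroup : ∀ Y k → Y * (suc (suc k) * suc (suc (suc k)) + k * suc k + (k + k))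
                    ≡ (Y + Y) * (suc k * suc (suc (suc k)))
    regroup = solve-∀

choose-drop-mono : ∀ m k → suc m ≤ double k →
                   m choose k + suc m choose suc k ≤ m choose suc k + suc m choose k
choose-drop-mono m (suc k) (s≤s m≤2k+1) = begin
  B + (B + C)    ≡⟨ shuffle B C ⟩
  C + (B + B)    ≤⟨ +-monoʳ-≤ C (+-monoˡ-≤ B (choose-suc≤choose m k m≤2k+1)) ⟩
  C + (A + B)    ∎
  where
  open ≤-Reasoning
  A = m choose k
  B = m choose suc k
  C = m choose suc (suc k)
  shuffle : ∀ B C → B + (B + C) ≡ C + (B + B)
  shuffle = solve-∀

choose-drop≤central : ∀ {m k} → m ≤‴ double k →
                      m choose k + double k choose suc k ≤ m choose suc k + double k choose k
choose-drop≤central {k = k} ≤‴-refl = ≤-reflexive (+-comm (double k choose k) (double k choose suc k))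
choose-drop≤central {m} {k} (≤‴-step m<2k) = +-cancelʳ-≤ (A′ + B′) _ _ (begin
  (a + T) + (A′ + B′)  ≡⟨ shuffle a T A′ B′ ⟩
  (a + B′) + (A′ + T)  ≤⟨ +-mono-≤ (choose-drop-mono m k (≤‴⇒≤ m<2k)) (choose-drop≤central m<2k) ⟩
  (b + A′) + (B′ + U)  ≡⟨ unshuffle b U A′ B′ ⟩
  (b + U) + (A′ + B′)  ∎)
  where
  open ≤-Reasoning
  a  = m choose k
  b  = m choose suc k
  A′ = suc m choose k
  B′ = suc m choose suc k
  T  = double k choose suc k
  U  = double k choose k
  shuffle : ∀ a T A′ B′ → (a + T) + (A′ + B′) ≡ (a + B′) + (A′ + T)
  shuffle = solve-∀
  unshuffle : ∀ b U A′ B′ → (b + A′) + (B′ + U) ≡ (b + U) + (A′ + B′)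
  unshuffle = solve-∀

catalan : ℕ → ℕ
catalan k = double k choose k ∸ double k choose suc k

catalan+choose : ∀ k → catalan k + double k choose suc k ≡ double k choose k
catalan+choose k = m∸n+n≡m (choose-suc≤choose (double k) k (n≤1+n _))

choose≤choose-suc+catalan : ∀ m k → m choose k ≤ m choose suc k + catalan k
choose≤choose-suc+catalan m k with suc (double k) ≤? m
... | yes 2k+1≤m = ≤-trans (choose≤choose-suc m k 2k+1≤m) (m≤m+n _ _)
... | no  2k+1≰m = +-cancelʳ-≤ T _ _ (begin
  m choose k + T                   ≤⟨ choose-drop≤central (≤⇒≤‴ (≤-pred (≰⇒> 2k+1≰m))) ⟩
  m choose suc k + double k choose k ≡⟨ cong (m choose suc k +_) (catalan+choose k) ⟨
  m choose suc k + (catalan k + T) ≡⟨ +-assoc (m choose suc k) (catalan k) T ⟨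
  m choose suc k + catalan k + T   ∎)
  where
  open ≤-Reasoning
  T = double k choose suc k

catalan-growth : ∀ k → catalan (suc k) + catalan (suc k) ≤ catalan (suc (suc k))
catalan-growth k = +-cancelʳ-≤ ((X + Y) + (Y + Z)) _ _ (begin
  c + c + ((X + Y) + (Y + Z))          ≡⟨ cong (λ x → c + c + ((x + Y) + (Y + Z))) c+Y≡X ⟨
  c + c + ((c + Y + Y) + (Y + Z))      ≡⟨ regroup c Y Z ⟩
  (c + Y) + (c + Y) + ((c + Y) + Z)    ≡⟨ cong (λ x → x + x + (x + Z)) c+Y≡X ⟩
  X + X + (X + Z)                      ≤⟨ +-monoʳ-≤ (X + X) (choose-concave-right-of-centre k) ⟩
  X + X + (Y + Y)                      ≡⟨ regroup′ X Y ⟩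
  (Y + X) + (X + Y)                    ≡⟨ cong (λ w → (w + X) + (X + Y)) (choose-symmetric-even k) ⟨
  (W + X) + (X + Y)                    ≡⟨ catalan+choose (suc (suc k)) ⟨
  catalan (suc (suc k)) + ((X + Y) + (Y + Z)) ∎)
  where
  open ≤-Reasoning
  n = double (suc k)
  W = n choose k
  X = n choose suc k
  Y = n choose suc (suc k)
  Z = n choose suc (suc (suc k))
  c = catalan (suc k)
  c+Y≡X : c + Y ≡ X
  c+Y≡X = catalan+choose (suc k)
  regroup : ∀ c Y Z → c + c + ((c + Y + Y) + (Y + Z)) ≡ (c + Y) + (c + Y) + ((c + Y) + Z)
  regroup = solve-∀
  regroup′ : ∀ X Y → X + X + (Y + Y) ≡ (Y + X) + (X + Y)
  regroup′ = solve-∀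

-- Bounds the drop of non-dominating counts below the middle (see LowerDrop).  At k = 0 the count
-- itself is at most 1; 2 · catalan 0 = 2 would make choose-suc+slack-mono false at j = 0.
slack : ℕ → ℕ
slack zero    = 1
slack (suc k) = catalan (suc k) + catalan (suc k)

choose≤choose-suc+slack : ∀ m k → m choose k ≤ m choose suc k + slack k
choose≤choose-suc+slack m zero    = choose≤choose-suc+catalan m 0
choose≤choose-suc+slack m (suc k) =
  ≤-trans (choose≤choose-suc+catalan m (suc k)) (+-monoʳ-≤ (m choose suc (suc k)) (m≤m+n _ _))

choose-suc+slack-mono : ∀ m j → m choose suc j + slack j ≤ m choose suc (suc j) + slack (suc j)
choose-suc+slack-mono m zero =
  ≤-trans (+-monoˡ-≤ 1 (choose≤choose-suc+catalan m 1)) (≤-reflexive (+-assoc (m choose 2) 1 1))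
choose-suc+slack-mono m (suc i) =
  ≤-trans (+-mono-≤ (choose≤choose-suc+catalan m (suc (suc i))) (catalan-growth i))
          (≤-reflexive (+-assoc (m choose suc (suc (suc i))) c c))
  where c = catalan (suc (suc i))

slack-at-middle : ∀ m j → double j ≡ suc m →
                  m choose suc j + slack j + suc (suc m) choose suc (suc j)
                  ≡ m choose suc (suc j) + suc (suc m) choose suc j
slack-at-middle .(suc (double i)) (suc i) refl = begin
  R + (c + c) + ((Q + R) + (R + S))          ≡⟨ cong (λ q → R + (c + c) + ((q + R) + (R + S))) Q≡c+R ⟩
  R + (c + c) + ((c + R + R) + (R + S))      ≡⟨ regroup c R S ⟩
  S + ((c + R + (c + R)) + ((c + R) + R))    ≡⟨ cong₂ (λ p q → S + ((p + q) + (q + R))) c+R≡P (sym Q≡c+R) ⟩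
  S + ((P + Q) + (Q + R))                    ∎
  where
  open ≡-Reasoning
  m = suc (double i)
  P = m choose i
  Q = m choose suc i
  R = m choose suc (suc i)
  S = m choose suc (suc (suc i))
  c = catalan (suc i)
  reassoc : ∀ c R Q → c + R + Q ≡ c + (Q + R)
  reassoc = solve-∀
  c+R≡P : c + R ≡ P
  c+R≡P = +-cancelʳ-≡ Q _ _ (trans (reassoc c R Q) (catalan+choose (suc i)))
  Q≡c+R : Q ≡ c + R
  Q≡c+R = trans (choose-central-odd i) (sym c+R≡P)
  regroup : ∀ c R S → R + (c + c) + ((c + R + R) + (R + S)) ≡ S + ((c + R + (c + R)) + ((c + R) + R))
  regroup = solve-∀

shift : (ℕ → ℕ) → ℕ → ℕ
shift c zero    = 0
shift c (suc k) = c k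

shift-cong : ∀ {c c′} → c ≗ c′ → shift c ≗ shift c′
shift-cong c≗c′ zero    = refl
shift-cong c≗c′ (suc k) = c≗c′ k

Unimodal-resp : ∀ {c c′ N} → c ≗ c′ → Unimodal c N → Unimodal c′ N
Unimodal-resp c≗c′ (j , j≤N , up , down) = j , j≤N ,
  (λ i i<j → subst₂ _≤_ (c≗c′ i) (c≗c′ (suc i)) (up i i<j)) ,
  (λ i j≤i i<N → subst₂ _≤_ (c≗c′ (suc i)) (c≗c′ i) (down i j≤i i<N))

Unimodal-shift : ∀ {c N} → Unimodal c N → Unimodal (shift c) (suc N)
Unimodal-shift {c} {N} (j , j≤N , up , down) = suc j , s≤s j≤N , up′ , down′
  where
  up′ : ∀ i → i < suc j → shift c i ≤ shift c (suc i)
  up′ zero    _         = z≤n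
  up′ (suc i) (s≤s i<j) = up i i<j
  down′ : ∀ i → suc j ≤ i → i < suc N → shift c (suc i) ≤ shift c i
  down′ (suc i) (s≤s j≤i) (s≤s i<N) = down i j≤i i<N

unimodal-around : ∀ c {N} h → h < N →
                  (∀ k → k < h → c k ≤ c (suc k)) →
                  (∀ k → h < k → k < N → c (suc k) ≤ c k) → Unimodal c N
unimodal-around c {N} h h<N inc dec with c (suc h) ≤? c h
... | yes fall = h , <⇒≤ h<N , inc , down
  where
  down : ∀ k → h ≤ k → k < N → c (suc k) ≤ c k
  down k h≤k k<N with m≤n⇒m<n∨m≡n h≤k
  ... | inj₁ h<k  = dec k h<k k<N
  ... | inj₂ refl = fall
... | no ¬fall = suc h , h<N , up , dec
  where
  up : ∀ k → k < suc h → c k ≤ c (suc k)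
  up k (s≤s k≤h) with m≤n⇒m<n∨m≡n k≤h
  ... | inj₁ k<h  = inc k k<h
  ... | inj₂ refl = <⇒≤ (≰⇒> ¬fall)

unimodal-from-middle : ∀ c N →
                       (∀ k → suc (double k) ≤ suc N → c k ≤ c (suc k)) →
                       (∀ k → suc (suc N) ≤ double k → c (suc k) ≤ c k) → Unimodal c (suc N)
unimodal-from-middle c N inc dec = unimodal-around c h (⌊n/2⌋<n N) inc′ dec′
  where
  h = ⌊ suc N /2⌋
  inc′ : ∀ k → k < h → c k ≤ c (suc k)
  inc′ k k<h = inc k (≤-trans (n≤1+n _) (≤-trans (double-mono-≤ k<h) (double-⌊/2⌋≤ (suc N))))
  dec′ : ∀ k → h < k → k < suc N → c (suc k) ≤ c k
  dec′ k h<k _ = dec k (≤-trans (s≤s (≤suc-double-⌊/2⌋ (suc N))) (double-mono-≤ h<k))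

-- Starting from D = 1 (coefficients 0 choose_), an isolated vertex multiplies D by x, and a vertex
-- adjacent to all of m + 1 ≥ 1 earlier vertices adds the sets containing it, x (1 + x) ^ (m + 1).
data ThresholdDomination : ℕ → (ℕ → ℕ) → Set where
  empty      : ThresholdDomination 0 (0 choose_)
  isolated   : ∀ {m c} → ThresholdDomination m c → ThresholdDomination (suc m) (shift c)
  dominating : ∀ {m c} → ThresholdDomination (suc m) c →
               ThresholdDomination (suc (suc m)) (λ k → shift (suc m choose_) k + c k)

coeff-0 : ∀ {m c} → ThresholdDomination (suc m) c → c 0 ≡ 0
coeff-0 (isolated t)   = refl
coeff-0 (dominating t) = coeff-0 t

nonDom : ∀ {m c} → ThresholdDomination m c → ℕ → ℕ
nonDom empty                  _ = 0
nonDom (isolated {m = m} t)   k = m choose k + shift (nonDom t) k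
nonDom (dominating t)         k = nonDom t k

nonDom-complement : ∀ {m c} (t : ThresholdDomination m c) k → c k + nonDom t k ≡ m choose k
nonDom-complement empty k = +-identityʳ (0 choose k)
nonDom-complement (isolated t) zero = refl
nonDom-complement (isolated {m = m} {c = c} t) (suc k) =
  trans (regroup (c k) (m choose suc k) (nonDom t k)) (cong (_+ m choose suc k) (nonDom-complement t k))
  where
  regroup : ∀ x y z → x + (y + z) ≡ (x + z) + y
  regroup = solve-∀
nonDom-complement (dominating t) zero = nonDom-complement t zero
nonDom-complement (dominating {m = m} {c = c} t) (suc k) =
  trans (+-assoc (suc m choose k) (c (suc k)) (nonDom t (suc k)))
        (cong (suc m choose k +_) (nonDom-complement t (suc k)))

coeff≤choose : ∀ {m c} → ThresholdDomination m c → ∀ k → c k ≤ m choose k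
coeff≤choose t k = subst (_ ≤_) (nonDom-complement t k) (m≤m+n _ _)

-- c k (m - k) ≤ c (k + 1) (k + 1), i.e. c k / C(m,k) ≤ c (k + 1) / C(m,k+1).
NormalizedMatching : ℕ → (ℕ → ℕ) → Set
NormalizedMatching m c = ∀ k → c k * suc m ≤ c (suc k) * suc k + c k * suc k

NormalizedMatching-increasing : ∀ {N c} → NormalizedMatching N c →
                                ∀ k → suc (double k) ≤ N → c k ≤ c (suc k)
NormalizedMatching-increasing {N} {c} nm k 2k+1≤N =
  *-cancelʳ-≤ _ _ (suc k) (+-cancelʳ-≤ (x * suc k) _ _ (begin
    x * suc k + x * suc k  ≡⟨ *-distribˡ-+ x (suc k) (suc k) ⟨
    x * (suc k + suc k)    ≡⟨ cong (x *_) (suc+suc≡double-suc k) ⟩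
    x * double (suc k)     ≤⟨ *-monoʳ-≤ x (s≤s 2k+1≤N) ⟩
    x * suc N              ≤⟨ nm k ⟩
    c (suc k) * suc k + x * suc k ∎))
  where
  open ≤-Reasoning
  x = c k

NormalizedMatching-0 : ∀ c → NormalizedMatching 0 c
NormalizedMatching-0 c k = ≤-trans (*-monoʳ-≤ (c k) (s≤s z≤n)) (m≤n+m _ _)

NormalizedMatching-shift : ∀ {m c} → NormalizedMatching m c → NormalizedMatching (suc m) (shift c)
NormalizedMatching-shift nm zero = z≤n
NormalizedMatching-shift {m} {c} nm (suc k) = begin
  x * suc (suc m)                     ≡⟨ peel x m ⟩
  x * suc m + x                       ≤⟨ +-monoˡ-≤ x (nm k) ⟩
  y * suc k + x * suc k + x           ≡⟨ +-assoc (y * suc k) (x * suc k) x ⟩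
  y * suc k + (x * suc k + x)         ≡⟨ cong (y * suc k +_) (peel x k) ⟨
  y * suc k + x * suc (suc k)         ≤⟨ +-monoˡ-≤ (x * suc (suc k)) (*-monoʳ-≤ y (n≤1+n (suc k))) ⟩
  y * suc (suc k) + x * suc (suc k)   ∎
  where
  open ≤-Reasoning
  x = c k
  y = c (suc k)
  peel : ∀ x m → x * suc (suc m) ≡ x * suc m + x
  peel = solve-∀

NormalizedMatching-dominating : ∀ {m c} → NormalizedMatching m c → c 0 ≡ 0 → (∀ k → c k ≤ m choose k) →
                                NormalizedMatching (suc m) (λ k → shift (m choose_) k + c k)
NormalizedMatching-dominating {m} {c} nm c0≡0 c≤C zero rewrite c0≡0 = z≤n
NormalizedMatching-dominating {m} {c} nm c0≡0 c≤C (suc k) = begin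
  (b + x) * suc (suc m)                                   ≡⟨ expand b x m ⟩
  (b * suc m + b) + (x * suc m + x)                       ≡⟨ cong (λ z → (z + b) + (x * suc m + x)) (choose-ratio m k) ⟨
  (b′ * suc k + b * suc k + b) + (x * suc m + x)          ≤⟨ +-monoʳ-≤ (b′ * suc k + b * suc k + b) (+-mono-≤ (nm (suc k)) (c≤C (suc k))) ⟩
  (b′ * suc k + b * suc k + b) + (y * suc (suc k) + x * suc (suc k) + b′) ≡⟨ collect b b′ x y k ⟩
  (b′ + y) * suc (suc k) + (b + x) * suc (suc k)          ∎
  where
  open ≤-Reasoning
  b  = m choose k
  b′ = m choose suc k
  x  = c (suc k)
  y  = c (suc (suc k))
  expand : ∀ b x m → (b + x) * suc (suc m) ≡ (b * suc m + b) + (x * suc m + x)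
  expand = solve-∀
  collect : ∀ b b′ x y k → (b′ * suc k + b * suc k + b) + (y * suc (suc k) + x * suc (suc k) + b′)
                         ≡ (b′ + y) * suc (suc k) + (b + x) * suc (suc k)
  collect = solve-∀

normalizedMatching : ∀ {m c} → ThresholdDomination m c → NormalizedMatching m c
normalizedMatching empty          = NormalizedMatching-0 (0 choose_)
normalizedMatching (isolated t)   = NormalizedMatching-shift (normalizedMatching t)
normalizedMatching (dominating t) =
  NormalizedMatching-dominating (normalizedMatching t) (coeff-0 t) (coeff≤choose t)

-- a k - a (k + 1) ≤ C(m+1,k) - C(m+1,k+1) beyond the middle: exactly what makes the sequence
-- decrease there once a dominating vertex is added to a graph with non-dominating counts a.
UpperDrop : ℕ → (ℕ → ℕ) → Set
UpperDrop m a = ∀ k → suc (suc m) ≤ double k → a k + suc m choose suc k ≤ a (suc k) + suc m choose k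

LowerDrop : ℕ → (ℕ → ℕ) → Set
LowerDrop m a = ∀ k → double k ≤ suc m → a k ≤ a (suc k) + slack k

UpperDrop-empty : UpperDrop 0 (λ _ → 0)
UpperDrop-empty (suc k) _ = z≤n

isolated-upper : ∀ {m a} → UpperDrop m a → LowerDrop m a → UpperDrop (suc m) (λ k → m choose k + shift a k)
isolated-upper {m} {a} upper lower (suc j) (s≤s (s≤s m+1≤2j)) with suc (suc m) ≤? double j
... | yes m+2≤2j = begin
  (C₁ + a j) + ((C₀ + C₁) + (C₁ + C₂))   ≡⟨ regroup (a j) C₀ C₁ C₂ ⟩
  (a j + (C₀ + C₁)) + (C₁ + (C₁ + C₂))   ≤⟨ +-mono-≤ (upper j m+2≤2j) (+-monoˡ-≤ (C₁ + C₂) C₁≤C₀) ⟩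
  (a (suc j) + V) + (C₀ + (C₁ + C₂))     ≡⟨ regroup′ (a (suc j)) V C₀ C₁ C₂ ⟩
  (C₂ + a (suc j)) + (V + (C₀ + C₁))     ∎
  where
  open ≤-Reasoning
  C₀ = m choose j
  C₁ = m choose suc j
  C₂ = m choose suc (suc j)
  V  = suc m choose j
  C₁≤C₀ : C₁ ≤ C₀
  C₁≤C₀ = choose-suc≤choose m j (≤-trans (n≤1+n m) (≤-trans m+1≤2j (n≤1+n _)))
  regroup : ∀ a C₀ C₁ C₂ → (C₁ + a) + ((C₀ + C₁) + (C₁ + C₂)) ≡ (a + (C₀ + C₁)) + (C₁ + (C₁ + C₂))
  regroup = solve-∀
  regroup′ : ∀ a V C₀ C₁ C₂ → (a + V) + (C₀ + (C₁ + C₂)) ≡ (C₂ + a) + (V + (C₀ + C₁))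
  regroup′ = solve-∀
... | no m+2≰2j = begin
  (C₁ + a j) + B₂                  ≤⟨ +-monoˡ-≤ B₂ (+-monoʳ-≤ C₁ (lower j 2j≤m+1)) ⟩
  (C₁ + (a (suc j) + slack j)) + B₂  ≡⟨ regroup C₁ (a (suc j)) (slack j) B₂ ⟩
  (C₁ + slack j + B₂) + a (suc j)    ≡⟨ cong (_+ a (suc j)) (slack-at-middle m j 2j≡m+1) ⟩
  (C₂ + B₁) + a (suc j)              ≡⟨ regroup′ C₂ B₁ (a (suc j)) ⟩
  (C₂ + a (suc j)) + B₁              ∎
  where
  open ≤-Reasoning
  C₁ = m choose suc j
  C₂ = m choose suc (suc j)
  B₁ = suc (suc m) choose suc j
  B₂ = suc (suc m) choose suc (suc j)
  2j≤m+1 : double j ≤ suc m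
  2j≤m+1 = ≤-pred (≰⇒> m+2≰2j)
  2j≡m+1 : double j ≡ suc m
  2j≡m+1 = ≤-antisym 2j≤m+1 m+1≤2j
  regroup : ∀ C a s B → (C + (a + s)) + B ≡ (C + s + B) + a
  regroup = solve-∀
  regroup′ : ∀ C B a → (C + B) + a ≡ (C + a) + B
  regroup′ = solve-∀

isolated-lower : ∀ {m a} → LowerDrop m a → LowerDrop (suc m) (λ k → m choose k + shift a k)
isolated-lower {m} {a} lower zero _ = m≤n+m 1 _
isolated-lower {m} {a} lower (suc j) (s≤s (s≤s 2j≤m)) = begin
  C₁ + a j                            ≤⟨ +-monoʳ-≤ C₁ (lower j (≤-trans 2j≤m (n≤1+n m))) ⟩
  C₁ + (a (suc j) + slack j)          ≡⟨ regroup C₁ (a (suc j)) (slack j) ⟩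
  (C₁ + slack j) + a (suc j)          ≤⟨ +-monoˡ-≤ (a (suc j)) (choose-suc+slack-mono m j) ⟩
  (C₂ + slack (suc j)) + a (suc j)    ≡⟨ regroup′ C₂ (slack (suc j)) (a (suc j)) ⟩
  (C₂ + a (suc j)) + slack (suc j)    ∎
  where
  open ≤-Reasoning
  C₁ = m choose suc j
  C₂ = m choose suc (suc j)
  regroup : ∀ C a s → C + (a + s) ≡ (C + s) + a
  regroup = solve-∀
  regroup′ : ∀ C s a → (C + s) + a ≡ (C + a) + s
  regroup′ = solve-∀

dominating-upper : ∀ {m a} → UpperDrop m a → UpperDrop (suc m) a
dominating-upper {m} {a} upper (suc k) (s≤s (s≤s m+1≤2k)) = begin
  a (suc k) + (B₁ + B₂)          ≡⟨ regroup (a (suc k)) B₁ B₂ ⟩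
  (a (suc k) + B₂) + B₁          ≤⟨ +-mono-≤ (upper (suc k) (s≤s (s≤s (≤-trans (n≤1+n m) m+1≤2k))))
                                             (choose-suc≤choose (suc m) k (≤-trans m+1≤2k (n≤1+n _))) ⟩
  (a (suc (suc k)) + B₁) + B₀    ≡⟨ regroup′ (a (suc (suc k))) B₀ B₁ ⟩
  a (suc (suc k)) + (B₀ + B₁)    ∎
  where
  open ≤-Reasoning
  B₀ = suc m choose k
  B₁ = suc m choose suc k
  B₂ = suc m choose suc (suc k)
  regroup : ∀ a B₁ B₂ → a + (B₁ + B₂) ≡ (a + B₂) + B₁
  regroup = solve-∀
  regroup′ : ∀ a B₀ B₁ → (a + B₁) + B₀ ≡ a + (B₀ + B₁)
  regroup′ = solve-∀

dominating-lower : ∀ {m a} → UpperDrop m a → LowerDrop m a → LowerDrop (suc m) a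
dominating-lower {m} {a} upper lower k _ with double k ≤? suc m
... | yes 2k≤m+1 = lower k 2k≤m+1
... | no  2k≰m+1 = +-cancelʳ-≤ B₁ _ _ (begin
  a k + B₁                    ≤⟨ upper k (≰⇒> 2k≰m+1) ⟩
  a (suc k) + B₀              ≤⟨ +-monoʳ-≤ (a (suc k)) (choose≤choose-suc+slack (suc m) k) ⟩
  a (suc k) + (B₁ + slack k)  ≡⟨ regroup (a (suc k)) B₁ (slack k) ⟩
  a (suc k) + slack k + B₁    ∎)
  where
  open ≤-Reasoning
  B₀ = suc m choose k
  B₁ = suc m choose suc k
  regroup : ∀ a B s → a + (B + s) ≡ a + s + B
  regroup = solve-∀

nonDom-drops : ∀ {m c} (t : ThresholdDomination m c) → UpperDrop m (nonDom t) × LowerDrop m (nonDom t)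
nonDom-drops empty = UpperDrop-empty , λ _ _ → z≤n
nonDom-drops (isolated t) with upper , lower ← nonDom-drops t =
  isolated-upper upper lower , isolated-lower lower
nonDom-drops (dominating t) with upper , lower ← nonDom-drops t =
  dominating-upper {a = nonDom t} upper , dominating-lower upper lower

≤-of-complements : ∀ {x x′ a a′ B B′} → x + a ≡ B → x′ + a′ ≡ B′ → a + B′ ≤ a′ + B → x′ ≤ x
≤-of-complements {x} {x′} {a} {a′} refl refl a+B′≤a′+B =
  +-cancelʳ-≤ (a + a′) x′ x (subst₂ _≤_ (regroup x′ a a′) (regroup′ x a a′) a+B′≤a′+B)
  where
  regroup : ∀ x′ a a′ → a + (x′ + a′) ≡ x′ + (a + a′)
  regroup = solve-∀
  regroup′ : ∀ x a a′ → a′ + (x + a) ≡ x + (a + a′)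
  regroup′ = solve-∀

thresholdDomination-unimodal : ∀ {n c} → ThresholdDomination n c → Unimodal c n
thresholdDomination-unimodal empty        = 0 , z≤n , (λ _ ()) , (λ _ _ ())
thresholdDomination-unimodal (isolated t) = Unimodal-shift (thresholdDomination-unimodal t)
thresholdDomination-unimodal t′@(dominating {m} {c} t) =
  unimodal-from-middle _ (suc m) (NormalizedMatching-increasing (normalizedMatching t′)) decreasing
  where
  decreasing : ∀ k → suc (suc (suc m)) ≤ double k →
               shift (suc m choose_) (suc k) + c (suc k) ≤ shift (suc m choose_) k + c k
  decreasing k m+3≤2k = ≤-of-complements (nonDom-complement t′ k) (nonDom-complement t′ (suc k))
                                          (proj₁ (nonDom-drops t) k m+3≤2k)

count : ∀ {A : Set} {P : A → Set} → Decidable P → List A → ℕ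
count P? xs = length (filter P? xs)

count-++ : ∀ {A : Set} {P : A → Set} (P? : Decidable P) xs ys →
           count P? (xs ++ ys) ≡ count P? xs + count P? ys
count-++ P? xs ys = trans (cong length (filter-++ P? xs ys)) (length-++ (filter P? xs))

count-map : ∀ {A B : Set} {P : A → Set} (P? : Decidable P) (f : B → A) xs →
            count P? (map f xs) ≡ count (P? ∘ f) xs
count-map P? f []       = refl
count-map P? f (x ∷ xs) with does (P? (f x))
... | true  = cong suc (count-map P? f xs)
... | false = count-map P? f xs

count-≐ : ∀ {A : Set} {P Q : A → Set} (P? : Decidable P) (Q? : Decidable Q) →
          (∀ {x} → P x → Q x) → (∀ {x} → Q x → P x) → ∀ xs → count P? xs ≡ count Q? xs
count-≐ P? Q? P⇒Q Q⇒P xs = cong length (filter-≐ P? Q? (P⇒Q , Q⇒P) xs)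

count-none : ∀ {A : Set} {P : A → Set} (P? : Decidable P) → (∀ x → ¬ P x) → ∀ xs → count P? xs ≡ 0
count-none P? ¬P xs = cong length (filter-none P? (universal ¬P xs))

count-subsets-insertAt : ∀ {n} (v : Fin (suc n)) {P : Subset (suc n) → Set} (P? : Decidable P) →
  count P? (subsets (suc n))
  ≡ count (λ S → P? (insertAt S v true)) (subsets n) + count (λ S → P? (insertAt S v false)) (subsets n)
count-subsets-insertAt {n} zero P? =
  trans (count-++ P? (map (true ∷_) (subsets n)) (map (false ∷_) (subsets n)))
        (cong₂ _+_ (count-map P? (true ∷_) (subsets n)) (count-map P? (false ∷_) (subsets n)))
count-subsets-insertAt {suc n} (suc v) P? = begin
  count P? (subsets (suc (suc n)))
    ≡⟨ count-subsets-insertAt zero P? ⟩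
  count (λ S → P? (true ∷ S)) (subsets (suc n)) + count (λ S → P? (false ∷ S)) (subsets (suc n))
    ≡⟨ cong₂ _+_ (count-subsets-insertAt v (λ S → P? (true ∷ S)))
                 (count-subsets-insertAt v (λ S → P? (false ∷ S))) ⟩
  (#tt + #tf) + (#ft + #ff)
    ≡⟨ interchange #tt #tf #ft #ff ⟩
  (#tt + #ft) + (#tf + #ff)
    ≡⟨ cong₂ _+_ (count-subsets-insertAt zero (λ S → P? (insertAt S (suc v) true)))
                 (count-subsets-insertAt zero (λ S → P? (insertAt S (suc v) false))) ⟨
  count (λ S → P? (insertAt S (suc v) true)) (subsets (suc n))
    + count (λ S → P? (insertAt S (suc v) false)) (subsets (suc n)) ∎
  where
  open ≡-Reasoning
  #tt = count (λ S → P? (true ∷ insertAt S v true)) (subsets n)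
  #tf = count (λ S → P? (true ∷ insertAt S v false)) (subsets n)
  #ft = count (λ S → P? (false ∷ insertAt S v true)) (subsets n)
  #ff = count (λ S → P? (false ∷ insertAt S v false)) (subsets n)
  interchange : ∀ a b c d → (a + b) + (c + d) ≡ (a + c) + (b + d)
  interchange = solve-∀

count-subsets-of-size : ∀ n k → count (λ (S : Subset n) → ∣ S ∣ ≟ k) (subsets n) ≡ n choose k
count-subsets-of-size zero    zero    = refl
count-subsets-of-size zero    (suc k) = refl
count-subsets-of-size (suc n) k = trans (count-subsets-insertAt {n} zero (λ S → ∣ S ∣ ≟ k)) (by-first k)
  where
  by-first : ∀ k → count (λ S → ∣ true ∷ S ∣ ≟ k) (subsets n) + count (λ S → ∣ false ∷ S ∣ ≟ k) (subsets n)
                   ≡ suc n choose k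
  by-first zero    = cong₂ _+_ (count-none (λ S → ∣ true ∷ S ∣ ≟ 0) (λ _ ()) (subsets n))
                              (count-subsets-of-size n 0)
  by-first (suc k) = cong₂ _+_
    (trans (count-≐ (λ S → ∣ true ∷ S ∣ ≟ suc k) (λ S → ∣ S ∣ ≟ k) suc-injective (cong suc) (subsets n))
           (count-subsets-of-size n k))
    (count-subsets-of-size n (suc k))

∣insertAt-true∣ : ∀ {n} (S : Subset n) v → ∣ insertAt S v true ∣ ≡ suc ∣ S ∣
∣insertAt-true∣ S           zero    = refl
∣insertAt-true∣ (true ∷ S)  (suc v) = cong suc (∣insertAt-true∣ S v)
∣insertAt-true∣ (false ∷ S) (suc v) = ∣insertAt-true∣ S v

∣insertAt-false∣ : ∀ {n} (S : Subset n) v → ∣ insertAt S v false ∣ ≡ ∣ S ∣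
∣insertAt-false∣ S           zero    = refl
∣insertAt-false∣ (true ∷ S)  (suc v) = cong suc (∣insertAt-false∣ S v)
∣insertAt-false∣ (false ∷ S) (suc v) = ∣insertAt-false∣ S v

module _ {n} (S : Subset n) (v : Fin (suc n)) where

  insertAt-true-∋ : v ∈ insertAt S v true
  insertAt-true-∋ = lookup⇒[]= v _ (insertAt-lookup S v true)

  insertAt-false-∌ : ¬ v ∈ insertAt S v false
  insertAt-false-∌ v∈ with () ← trans (sym (insertAt-lookup S v false)) ([]=⇒lookup v∈)

  punchIn∈insertAt⁻ : ∀ {b} i → punchIn v i ∈ insertAt S v b → i ∈ S
  punchIn∈insertAt⁻ {b} i i∈ = lookup⇒[]= i S (trans (sym (insertAt-punchIn S v b i)) ([]=⇒lookup i∈))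

  punchIn∈insertAt⁺ : ∀ {b} i → i ∈ S → punchIn v i ∈ insertAt S v b
  punchIn∈insertAt⁺ {b} i i∈ = lookup⇒[]= (punchIn v i) _ (trans (insertAt-punchIn S v b i) ([]=⇒lookup i∈))

punchIn-view : ∀ {n} (v w : Fin (suc n)) → w ≡ v ⊎ ∃[ i ] (w ≡ punchIn v i)
punchIn-view v w with v Fin.≟ w
... | yes v≡w = inj₁ (sym v≡w)
... | no  v≢w = inj₂ (punchOut v≢w , sym (Fin.punchIn-punchOut v≢w))

deleteVertex : ∀ {n} → Fin (suc n) → Graph (suc n) → Graph n
deleteVertex v G = record
  { adj    = λ i j → adj G (punchIn v i) (punchIn v j)
  ; sym    = λ i j → Graph.sym G (punchIn v i) (punchIn v j)
  ; irrefl = λ i → irrefl G (punchIn v i)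
  }

DominatedBy : ∀ {n} → Graph n → Subset n → Fin n → Set
DominatedBy G X w = w ∈ X ⊎ ∃[ u ] (u ∈ X × Adj G u w)

module _ {n} (G : Graph (suc n)) (v : Fin (suc n)) where

  private
    G-v = deleteVertex v G

  dominating-deleteVertex : ∀ {b} S → (∀ i → v ∈ insertAt S v b → ¬ Adj G v (punchIn v i)) →
                            Dominating G (insertAt S v b) → Dominating G-v S
  dominating-deleteVertex S v-useless dom i with dom (punchIn v i)
  ... | inj₁ i∈ = inj₁ (punchIn∈insertAt⁻ S v i i∈)
  ... | inj₂ (u , u∈ , u~i) with punchIn-view v u
  ...   | inj₁ refl       = ⊥-elim (v-useless i u∈ u~i)
  ...   | inj₂ (j , refl) = inj₂ (j , punchIn∈insertAt⁻ S v j u∈ , u~i)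

  dominating-insertAt : ∀ {b} S → DominatedBy G (insertAt S v b) v → Dominating G-v S →
                        Dominating G (insertAt S v b)
  dominating-insertAt S v-dominated dom w with punchIn-view v w
  ... | inj₁ refl = v-dominated
  ... | inj₂ (i , refl) with dom i
  ...   | inj₁ i∈            = inj₁ (punchIn∈insertAt⁺ S v i i∈)
  ...   | inj₂ (j , j∈ , j~i) = inj₂ (punchIn v j , punchIn∈insertAt⁺ S v j j∈ , j~i)

Isolated : ∀ {n} → Graph n → Fin n → Set
Isolated G v = ∀ u → adj G u v ≡ false

Universal : ∀ {n} → Graph n → Fin n → Set
Universal G v = ∀ u → u ≢ v → Adj G u v

sizedDominating? : ∀ {n} (G : Graph n) k → Decidable (λ S → ∣ S ∣ ≡ k × Dominating G S)
sizedDominating? G k S = (∣ S ∣ ≟ k) ×-dec dominating? G S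

isolated-domCoeff : ∀ {n} (G : Graph (suc n)) v → Isolated G v →
                    domCoeff G ≗ shift (domCoeff (deleteVertex v G))
isolated-domCoeff {n} G v iso k =
  trans (count-subsets-insertAt v (sizedDominating? G k))
        (trans (cong₂ _+_ (with-v k) (count-none _ (λ S → without-v S ∘ proj₂) (subsets n)))
               (+-identityʳ _))
  where
  v-useless : ∀ S i → v ∈ insertAt S v true → ¬ Adj G v (punchIn v i)
  v-useless S i _ v~i with () ← trans (sym v~i) (trans (Graph.sym G v _) (iso _))
  without-v : ∀ S → ¬ Dominating G (insertAt S v false)
  without-v S dom with dom v
  ... | inj₁ v∈              = insertAt-false-∌ S v v∈
  ... | inj₂ (u , _ , u~v) with () ← trans (sym u~v) (iso u)
  with-v : ∀ k → count (λ S → sizedDominating? G k (insertAt S v true)) (subsets n)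
                 ≡ shift (domCoeff (deleteVertex v G)) k
  with-v zero    = count-none _ (λ S (size , _) → 0≢1+n (trans (sym size) (∣insertAt-true∣ S v))) (subsets n)
  with-v (suc k) = count-≐ _ (sizedDominating? (deleteVertex v G) k)
    (λ {S} (size , dom) → suc-injective (trans (sym (∣insertAt-true∣ S v)) size) ,
                          dominating-deleteVertex G v S (v-useless S) dom)
    (λ {S} (size , dom) → trans (∣insertAt-true∣ S v) (cong suc size) ,
                          dominating-insertAt G v S (inj₁ (insertAt-true-∋ S v)) dom)
    (subsets n)

universal-domCoeff : ∀ {n} (G : Graph (suc (suc n))) v → Universal G v →
                     domCoeff G ≗ λ k → shift (suc n choose_) k + domCoeff (deleteVertex v G) k
universal-domCoeff {n} G v univ k =
  trans (count-subsets-insertAt v (sizedDominating? G k)) (cong₂ _+_ (with-v k) without-v)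
  where
  with-v-dominating : ∀ S → Dominating G (insertAt S v true)
  with-v-dominating S w with punchIn-view v w
  ... | inj₁ refl       = inj₁ (insertAt-true-∋ S v)
  ... | inj₂ (i , refl) = inj₂ (v , insertAt-true-∋ S v , trans (Graph.sym G v _) (univ _ (Fin.punchInᵢ≢i v i)))
  with-v : ∀ k → count (λ S → sizedDominating? G k (insertAt S v true)) (subsets (suc n))
                 ≡ shift (suc n choose_) k
  with-v zero    = count-none _ (λ S (size , _) → 0≢1+n (trans (sym size) (∣insertAt-true∣ S v))) (subsets (suc n))
  with-v (suc k) = trans
    (count-≐ _ (λ S → ∣ S ∣ ≟ k)
      (λ {S} (size , _) → suc-injective (trans (sym (∣insertAt-true∣ S v)) size))
      (λ {S} size → trans (∣insertAt-true∣ S v) (cong suc size) , with-v-dominating S)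
      (subsets (suc n)))
    (count-subsets-of-size (suc n) k)
  without-v : count (λ S → sizedDominating? G k (insertAt S v false)) (subsets (suc n))
              ≡ domCoeff (deleteVertex v G) k
  without-v = count-≐ _ (sizedDominating? (deleteVertex v G) k)
    (λ {S} (size , dom) → trans (sym (∣insertAt-false∣ S v)) size ,
                          dominating-deleteVertex G v S (λ _ v∈ _ → insertAt-false-∌ S v v∈) dom)
    (λ {S} (size , dom) → trans (∣insertAt-false∣ S v) size ,
                          dominating-insertAt G v S (v-dominated S dom) dom)
    (subsets (suc n))
    where
    v-dominated : ∀ S → Dominating (deleteVertex v G) S → DominatedBy G (insertAt S v false) v
    v-dominated S dom with dom zero
    ... | inj₁ 0∈            = inj₂ (punchIn v zero , punchIn∈insertAt⁺ S v zero 0∈ , univ _ (Fin.punchInᵢ≢i v zero))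
    ... | inj₂ (j , j∈ , _)  = inj₂ (punchIn v j , punchIn∈insertAt⁺ S v j j∈ , univ _ (Fin.punchInᵢ≢i v j))

punchIn-mono-< : ∀ {n} p (i j : Fin n) → i Fin.< j → punchIn p i Fin.< punchIn p j
punchIn-mono-< p i j i<j = Fin.≤∧≢⇒< (Fin.punchIn-mono-≤ p i j (<⇒≤ i<j))
                                     (<⇒≢ i<j ∘ cong toℕ ∘ Fin.punchIn-injective p i j)

threshold-lastVertex : ∀ {n} (G : Graph (suc n)) → IsThreshold G →
                       ∃[ v ] ((Isolated G v ⊎ Universal G v) × IsThreshold (deleteVertex v G))
threshold-lastVertex {n} G (σ , ordered) = v , kind , remove last σ , ordered′
  where
  last = fromℕ n
  v    = σ ⟨$⟩ʳ last
  earlier : ∀ u → u ≢ v → ∃[ i ] (i Fin.< last × σ ⟨$⟩ʳ i ≡ u)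
  earlier u u≢v = σ ⟨$⟩ˡ u
                , Fin.≤∧≢⇒< (Fin.≤fromℕ _) (λ e → u≢v (trans (sym (inverseʳ σ)) (cong (σ ⟨$⟩ʳ_) e)))
                , inverseʳ σ
  kind : Isolated G v ⊎ Universal G v
  kind with ordered last
  ... | inj₁ none = inj₁ v-isolated
    where
    v-isolated : Isolated G v
    v-isolated u with u Fin.≟ v
    ... | yes refl = irrefl G v
    ... | no  u≢v with i , i<last , refl ← earlier u u≢v = none i i<last
  ... | inj₂ all = inj₂ v-universal
    where
    v-universal : Universal G v
    v-universal u u≢v with i , i<last , refl ← earlier u u≢v = all i i<last
  ordered′ : ∀ j → (∀ i → i Fin.< j → adj (deleteVertex v G) (remove last σ ⟨$⟩ʳ i) (remove last σ ⟨$⟩ʳ j) ≡ false)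
                 ⊎ (∀ i → i Fin.< j → adj (deleteVertex v G) (remove last σ ⟨$⟩ʳ i) (remove last σ ⟨$⟩ʳ j) ≡ true)
  ordered′ j with ordered (punchIn last j)
  ... | inj₁ none = inj₁ λ i i<j → subst₂ (λ x y → adj G x y ≡ false)
          (punchIn-permute σ last i) (punchIn-permute σ last j) (none _ (punchIn-mono-< last i j i<j))
  ... | inj₂ all  = inj₂ λ i i<j → subst₂ (λ x y → adj G x y ≡ true)
          (punchIn-permute σ last i) (punchIn-permute σ last j) (all _ (punchIn-mono-< last i j i<j))

HasThresholdDomination : ∀ {n} → Graph n → Set
HasThresholdDomination {n} G = ∃[ c ] (ThresholdDomination n c × c ≗ domCoeff G)

add-isolated : ∀ {n} (G : Graph (suc n)) v → Isolated G v →
               HasThresholdDomination (deleteVertex v G) → HasThresholdDomination G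
add-isolated G v iso (c , t , c≗) =
  shift c , isolated t , λ k → trans (shift-cong c≗ k) (sym (isolated-domCoeff G v iso k))

add-vertex : ∀ {n} (G : Graph (suc n)) v → Isolated G v ⊎ Universal G v →
             HasThresholdDomination (deleteVertex v G) → HasThresholdDomination G
add-vertex G v (inj₁ iso) = add-isolated G v iso
add-vertex {zero} G zero (inj₂ _) = add-isolated G zero λ { zero → irrefl G zero }
add-vertex {suc n} G v (inj₂ univ) (c , t , c≗) =
  _ , dominating t , λ k → trans (cong (shift (suc n choose_) k +_) (c≗ k)) (sym (universal-domCoeff G v univ k))

threshold-domination : ∀ n (G : Graph n) → IsThreshold G → HasThresholdDomination G
threshold-domination zero    G _ = 0 choose_ , empty , λ { zero → refl ; (suc k) → refl }
threshold-domination (suc n) G thr with v , kind , thr′ ← threshold-lastVertex G thr =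
  add-vertex G v kind (threshold-domination n (deleteVertex v G) thr′)

theorem19 : ∀ (n : ℕ) (T : Graph n) → IsThreshold T → Unimodal (domCoeff T) n
theorem19 n T thr with c , t , c≗ ← threshold-domination n T thr =
  Unimodal-resp c≗ (thresholdDomination-unimodal t)
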